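{- Let $m, n \in \mathbb{N}$, let $\tau = m-n+1$, and let $a, b, c, z, q$ be independent indeterminates (so the identity below is an identity of rational functions in $a,b,c,z,q$). Then $$\sum_{1\leq i_{1}\leq i_{2}\leq \cdots \leq i_{\tau}\leq n}\ \prod_{k=1}^{\tau}\frac{a-bq^{i_{k}}}{c-zq^{i_{k}}} \;=\; \frac{c^n\,(zq/c;q)_{n}}{(q;q)_{n}\,(az-bc)^{n-1}}\sum_{i=1}^n{n \brack i}\frac{(-1)^{i-1} q^{\binom{i+1}{2}-ni}(1-q^i)(a-bq^i)^m}{(c-zq^i)^{\tau+1}}.$$ In particular, for $m=n$: $$\sum_{i=1}^n\frac{a-bq^i}{c-zq^i}=\frac{c^n(zq/c;q)_{n}}{(q;q)_{n}(az-bc)^{n-1}}\sum_{i=1}^n{n \brack i}\frac{(-1)^{i-1} q^{\binom{i+1}{2}-ni}(1-q^i)(a-bq^i)^n}{(c-zq^i)^2}.$$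
   Context: For an indeterminate $w$ and $k\in\mathbb{N}$, $(w;q)_k=(1-w)(1-wq)\cdots(1-wq^{k-1})$ (with $(w;q)_0=1$); thus $(zq/c;q)_n=\prod_{j=1}^n(1-zq^j/c)$. The Gauss polynomial is ${n \brack i}=\frac{(q;q)_n}{(q;q)_i\,(q;q)_{n-i}}$. The left-hand side of the first identity is the complete homogeneous symmetric function $h_\tau$ evaluated at the $n$ quantities $\frac{a-bq^{j}}{c-zq^{j}}$, $j=1,\dots,n$; by convention it equals $1$ when $\tau=0$ and $0$ when $\tau<0$. -}

module Defs where

open import Level using (Level; _⊔_) renaming (suc to lsuc)
open import Algebra.Bundles using (CommutativeRing)
open import Data.Nat as ℕ using (ℕ; zero; suc; _∸_)
open import Data.Nat.Combinatorics using (_C_)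
open import Data.Integer as ℤ using (ℤ; +_; -[1+_])
open import Relation.Nullary using (¬_)

-- A field: a commutative ring (with setoid equality ≈), 0 ≉ 1, and a total
-- function _⁻¹ which is a multiplicative inverse on every nonzero element
-- (its value at 0 is irrelevant: it is never used at 0 below, since all
-- denominators are assumed nonzero).
record Field (c ℓ : Level) : Set (lsuc (c ⊔ ℓ)) where
  field
    commutativeRing : CommutativeRing c ℓ
  open CommutativeRing commutativeRing public
  field
    0≉1 : ¬ (0# ≈ 1#)
    _⁻¹ : Carrier → Carrier
    ⁻¹-inverse : ∀ x → ¬ (x ≈ 0#) → x * (x ⁻¹) ≈ 1#

module FieldDefs {c ℓ : Level} (F : Field c ℓ) where
  open Field F

  infixl 7 _/_
  _/_ : Carrier → Carrier → Carrier
  x / y = x * (y ⁻¹)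

  infixr 8 _^_
  _^_ : Carrier → ℕ → Carrier
  x ^ zero = 1#
  x ^ suc k = x * (x ^ k)

  infixr 8 _^ℤ_
  _^ℤ_ : Carrier → ℤ → Carrier
  x ^ℤ (+ k) = x ^ k
  x ^ℤ -[1+ k ] = (x ⁻¹) ^ suc k

  sumFrom : (ℕ → Carrier) → ℕ → ℕ → Carrier
  sumFrom f lo zero = 0#
  sumFrom f lo (suc k) = f lo + sumFrom f (suc lo) k

  prodFrom : (ℕ → Carrier) → ℕ → ℕ → Carrier
  prodFrom f lo zero = 1#
  prodFrom f lo (suc k) = f lo * prodFrom f (suc lo) k

  -- Σ_{i=lo}^{hi} f i  and  Π_{i=lo}^{hi} f i  (empty if hi < lo)
  sumRange : ℕ → ℕ → (ℕ → Carrier) → Carrier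
  sumRange lo hi f = sumFrom f lo (suc hi ∸ lo)

  prodRange : ℕ → ℕ → (ℕ → Carrier) → Carrier
  prodRange lo hi f = prodFrom f lo (suc hi ∸ lo)

  qPoch : Carrier → Carrier → ℕ → Carrier
  qPoch w q k = prodFrom (λ j → 1# - w * q ^ j) 0 k

  gauss : Carrier → ℕ → ℕ → Carrier
  gauss q n i = qPoch q q n / (qPoch q q i * qPoch q q (n ∸ i))

  -- incSeqSum n x k lo = Σ_{lo ≤ i₁ ≤ i₂ ≤ ... ≤ i_k ≤ n} Π_{r=1}^{k} x i_r
  incSeqSum : ℕ → (ℕ → Carrier) → ℕ → ℕ → Carrier
  incSeqSum n x zero lo = 1#
  incSeqSum n x (suc k) lo = sumRange lo n (λ i → x i * incSeqSum n x k i)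

  hSum : ℕ → (ℕ → Carrier) → ℤ → Carrier
  hSum n x (+ k) = incSeqSum n x k 1
  hSum n x -[1+ k ] = 0#

  tau : ℕ → ℕ → ℤ
  tau m n = (+ m ℤ.- + n) ℤ.+ + 1

  ratio : (a b c z q : Carrier) → ℕ → Carrier
  ratio a b c z q j = (a - b * q ^ j) / (c - z * q ^ j)

  lhs : (m n : ℕ) (a b c z q : Carrier) → Carrier
  lhs m n a b c z q = hSum n (ratio a b c z q) (tau m n)

  rhs : (m n : ℕ) (a b c z q : Carrier) → Carrier
  rhs m n a b c z q =
    ((c ^ n * qPoch (z * q / c) q n) / (qPoch q q n * ((a * z - b * c) ^ℤ (+ n ℤ.- + 1))))
    * sumRange 1 n (λ i →
        gauss q n i *
        (((- 1#) ^ (i ∸ 1) * q ^ℤ (+ (suc i C 2) ℤ.- + (n ℕ.* i)) * (1# - q ^ i) * (a - b * q ^ i) ^ m)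
          / ((c - z * q ^ i) ^ℤ (tau m n ℤ.+ + 1))))

  lhsSpecial : (n : ℕ) (a b c z q : Carrier) → Carrier
  lhsSpecial n a b c z q = sumRange 1 n (ratio a b c z q)

  rhsSpecial : (n : ℕ) (a b c z q : Carrier) → Carrier
  rhsSpecial n a b c z q =
    ((c ^ n * qPoch (z * q / c) q n) / (qPoch q q n * ((a * z - b * c) ^ℤ (+ n ℤ.- + 1))))
    * sumRange 1 n (λ i →
        gauss q n i *
        (((- 1#) ^ (i ∸ 1) * q ^ℤ (+ (suc i C 2) ℤ.- + (n ℕ.* i)) * (1# - q ^ i) * (a - b * q ^ i) ^ n)
          / ((c - z * q ^ i) ^ 2)))

{-# OPTIONS --safe #-}
-- Write xⱼ = (a - b qʲ)/(c - z qʲ). These n points are distinct, and at distinct points the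
-- complete homogeneous polynomial h_{m-n+1} is the divided difference of u ↦ uᵐ, whose Lagrange
-- form is Σᵢ xᵢᵐ / Πⱼ≠ᵢ (xᵢ - xⱼ). Since
--   xᵢ - xⱼ = (az - bc)(qⁱ - qʲ) / ((c - z qⁱ)(c - z qʲ)),
-- the i-th denominator splits into a power of (az - bc)/(c - z qⁱ), the product
--   Πⱼ≠ᵢ (qⁱ - qʲ) = (-1)^{i-1} q^{C(i,2) + i(n-i)} (q;q)_{i-1} (q;q)_{n-i},
-- and Πⱼ≠ᵢ (c - z qʲ)⁻¹ = (c - z qⁱ) / (cⁿ (zq/c;q)ₙ); collecting these turns the i-th
-- Lagrange term into the i-th summand on the right.
module Submission where

open import Level using (Level; _⊔_)
open import Algebra.Bundles using (CommutativeRing)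
import Algebra.Solver.Ring.AlmostCommutativeRing as ACR
open import Data.Maybe as Maybe using (Maybe)
open import Data.Nat as ℕ using (ℕ; zero; suc; _∸_; _≤_; _<_; z≤n; s≤s)
import Data.Nat.Properties as ℕP
open import Data.Integer as ℤ using (ℤ; +_; -[1+_]; _⊖_)
import Data.Integer.Properties as ℤP
open import Data.List using (List; []; _∷_; length)
open import Data.List.Relation.Unary.All as All using (All; []; _∷_)
open import Data.Product using (_×_; _,_; proj₁; proj₂)
open import Relation.Binary.Consequences using (dec⇒weaklyDec)
open import Relation.Binary.PropositionalEquality as ≡ using (_≡_)
open import Relation.Nullary using (yes; no; ¬_)
open import Defs

module IntegerCoefficients {c ℓ : Level} (R : CommutativeRing c ℓ) where
  open CommutativeRing R
  open import Algebra.Properties.Semiring.Mult.TCOptimised semiring using (×-homo-+; ×1-homo-*) renaming (_×_ to _·_)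
  open import Algebra.Properties.Ring ring using (-‿distribˡ-*; -‿distribʳ-*; -‿involutive; -0#≈0#; -‿+-comm)
  open import Algebra.Properties.AbelianGroup +-abelianGroup using (xyx⁻¹≈y; ⁻¹-anti-homo‿-)
  open import Relation.Binary.Reasoning.Setoid setoid

  fromℤ : ℤ → Carrier
  fromℤ (+ n) = n · 1#
  fromℤ -[1+ n ] = - (suc n · 1#)

  fromℤ-neg+ : ∀ n → fromℤ (ℤ.- + n) ≈ - (n · 1#)
  fromℤ-neg+ zero = sym -0#≈0#
  fromℤ-neg+ (suc n) = refl

  fromℤ-⊖ : ∀ m n → fromℤ (m ⊖ n) ≈ m · 1# - n · 1#
  fromℤ-⊖ m n with m ℕ.<? n
  ... | no m≮n rewrite ℤP.⊖-≥ (ℕP.≮⇒≥ m≮n) = begin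
    (m ∸ n) · 1#                      ≈⟨ xyx⁻¹≈y (n · 1#) ((m ∸ n) · 1#) ⟨
    n · 1# + (m ∸ n) · 1# - n · 1#    ≈⟨ +-congʳ (×-homo-+ 1# n (m ∸ n)) ⟨
    (n ℕ.+ (m ∸ n)) · 1# - n · 1#     ≡⟨ ≡.cong (λ k → k · 1# - n · 1#) (ℕP.m+[n∸m]≡n (ℕP.≮⇒≥ m≮n)) ⟩
    m · 1# - n · 1#                   ∎
  ... | yes m<n rewrite ℤP.⊖-< m<n = begin
    fromℤ (ℤ.- + (n ∸ m))                     ≈⟨ fromℤ-neg+ (n ∸ m) ⟩
    - ((n ∸ m) · 1#)                          ≈⟨ -‿cong (xyx⁻¹≈y (m · 1#) ((n ∸ m) · 1#)) ⟨
    - (m · 1# + (n ∸ m) · 1# - m · 1#)        ≈⟨ -‿cong (+-congʳ (×-homo-+ 1# m (n ∸ m))) ⟨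
    - ((m ℕ.+ (n ∸ m)) · 1# - m · 1#)         ≡⟨ ≡.cong (λ k → - (k · 1# - m · 1#)) (ℕP.m+[n∸m]≡n (ℕP.<⇒≤ m<n)) ⟩
    - (n · 1# - m · 1#)                       ≈⟨ ⁻¹-anti-homo‿- (n · 1#) (m · 1#) ⟩
    m · 1# - n · 1#                           ∎

  fromℤ-+ : ∀ i j → fromℤ (i ℤ.+ j) ≈ fromℤ i + fromℤ j
  fromℤ-+ (+ m) (+ n) = ×-homo-+ 1# m n
  fromℤ-+ (+ m) -[1+ n ] = fromℤ-⊖ m (suc n)
  fromℤ-+ -[1+ m ] (+ n) = trans (fromℤ-⊖ n (suc m)) (+-comm _ _)
  fromℤ-+ -[1+ m ] -[1+ n ] = begin
    - (suc (suc (m ℕ.+ n)) · 1#)      ≡⟨ ≡.cong (λ k → - (suc k · 1#)) (ℕP.+-suc m n) ⟨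
    - ((suc m ℕ.+ suc n) · 1#)        ≈⟨ -‿cong (×-homo-+ 1# (suc m) (suc n)) ⟩
    - (suc m · 1# + suc n · 1#)       ≈⟨ -‿+-comm _ _ ⟨
    - (suc m · 1#) + - (suc n · 1#)   ∎

  fromℤ-neg : ∀ i → fromℤ (ℤ.- i) ≈ - fromℤ i
  fromℤ-neg (+ n) = fromℤ-neg+ n
  fromℤ-neg -[1+ n ] = sym (-‿involutive _)

  fromℤ-* : ∀ i j → fromℤ (i ℤ.* j) ≈ fromℤ i * fromℤ j
  fromℤ-* (+ m) (+ n) rewrite ℤP.+◃n≡+n (m ℕ.* n) = ×1-homo-* m n
  fromℤ-* (+ m) -[1+ n ] rewrite ℤP.-◃n≡-n (m ℕ.* suc n) = begin
    fromℤ (ℤ.- + (m ℕ.* suc n))       ≈⟨ fromℤ-neg+ (m ℕ.* suc n) ⟩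
    - ((m ℕ.* suc n) · 1#)            ≈⟨ -‿cong (×1-homo-* m (suc n)) ⟩
    - ((m · 1#) * (suc n · 1#))       ≈⟨ -‿distribʳ-* _ _ ⟩
    (m · 1#) * - (suc n · 1#)         ∎
  fromℤ-* -[1+ m ] (+ n) rewrite ℤP.-◃n≡-n (suc m ℕ.* n) = begin
    fromℤ (ℤ.- + (suc m ℕ.* n))       ≈⟨ fromℤ-neg+ (suc m ℕ.* n) ⟩
    - ((suc m ℕ.* n) · 1#)            ≈⟨ -‿cong (×1-homo-* (suc m) n) ⟩
    - ((suc m · 1#) * (n · 1#))       ≈⟨ -‿distribˡ-* _ _ ⟩
    - (suc m · 1#) * (n · 1#)         ∎
  fromℤ-* -[1+ m ] -[1+ n ] rewrite ℤP.+◃n≡+n (suc m ℕ.* suc n) = begin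
    (suc m ℕ.* suc n) · 1#            ≈⟨ ×1-homo-* (suc m) (suc n) ⟩
    (suc m · 1#) * (suc n · 1#)       ≈⟨ -‿involutive _ ⟨
    - - ((suc m · 1#) * (suc n · 1#)) ≈⟨ -‿cong (-‿distribˡ-* _ _) ⟩
    - (- (suc m · 1#) * (suc n · 1#)) ≈⟨ -‿distribʳ-* _ _ ⟩
    - (suc m · 1#) * - (suc n · 1#)   ∎

  fromℤ-morphism : ℤ.+-*-rawRing ACR.-Raw-AlmostCommutative⟶ ACR.fromCommutativeRing R
  fromℤ-morphism = record
    { ⟦_⟧ = fromℤ ; +-homo = fromℤ-+ ; *-homo = fromℤ-* ; -‿homo = fromℤ-neg
    ; 0-homo = refl ; 1-homo = refl }

  fromℤ-≟ : ∀ i j → Maybe (fromℤ i ≈ fromℤ j)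
  fromℤ-≟ i j = Maybe.map (λ i≡j → reflexive (≡.cong fromℤ i≡j)) (dec⇒weaklyDec ℤ._≟_ i j)

  open import Algebra.Solver.Ring ℤ.+-*-rawRing (ACR.fromCommutativeRing R) fromℤ-morphism fromℤ-≟ public

module FieldProperties {c ℓ : Level} (F : Field c ℓ) where
  open Field F
  open FieldDefs F
  open IntegerCoefficients commutativeRing public
  open import Algebra.Properties.Ring ring using (-‿involutive; -0#≈0#)
  open import Algebra.Properties.AbelianGroup +-abelianGroup using (⁻¹-anti-homo‿-)
  open import Algebra.Properties.CommutativeSemigroup *-commutativeSemigroup public
    using () renaming (interchange to *-interchange; xy∙z≈xz∙y to xy*z≈xz*y)
  open import Algebra.Properties.CommutativeSemigroup +-commutativeSemigroup public
    using () renaming (interchange to +-interchange)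
  open import Relation.Binary.Reasoning.Setoid setoid

  1≉0 : 1# ≉ 0#
  1≉0 1≈0 = 0≉1 (sym 1≈0)

  ≉0-resp-≈ : ∀ {x y} → x ≈ y → x ≉ 0# → y ≉ 0#
  ≉0-resp-≈ x≈y x≉0 y≈0 = x≉0 (trans x≈y y≈0)

  -‿≉0 : ∀ {x} → x ≉ 0# → - x ≉ 0#
  -‿≉0 x≉0 -x≈0 = x≉0 (trans (sym (-‿involutive _)) (trans (-‿cong -x≈0) -0#≈0#))

  x-y≉0⇒y-x≉0 : ∀ {x y} → x - y ≉ 0# → y - x ≉ 0#
  x-y≉0⇒y-x≉0 {x} {y} x-y≉0 = ≉0-resp-≈ (⁻¹-anti-homo‿- x y) (-‿≉0 x-y≉0)

  ⁻¹-inverseʳ : ∀ {x} → x ≉ 0# → x * x ⁻¹ ≈ 1#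
  ⁻¹-inverseʳ = ⁻¹-inverse _

  ⁻¹-inverseˡ : ∀ {x} → x ≉ 0# → x ⁻¹ * x ≈ 1#
  ⁻¹-inverseˡ x≉0 = trans (*-comm _ _) (⁻¹-inverseʳ x≉0)

  x*y≈0⇒y≈0 : ∀ {x y} → x ≉ 0# → x * y ≈ 0# → y ≈ 0#
  x*y≈0⇒y≈0 {x} {y} x≉0 xy≈0 = begin
    y               ≈⟨ *-identityˡ y ⟨
    1# * y          ≈⟨ *-congʳ (⁻¹-inverseˡ x≉0) ⟨
    (x ⁻¹ * x) * y  ≈⟨ *-assoc _ _ _ ⟩
    x ⁻¹ * (x * y)  ≈⟨ *-congˡ xy≈0 ⟩
    x ⁻¹ * 0#       ≈⟨ zeroʳ _ ⟩
    0#              ∎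

  *-≉0 : ∀ {x y} → x ≉ 0# → y ≉ 0# → x * y ≉ 0#
  *-≉0 x≉0 y≉0 xy≈0 = y≉0 (x*y≈0⇒y≈0 x≉0 xy≈0)

  ⁻¹-unique : ∀ {x y} → x ≉ 0# → x * y ≈ 1# → x ⁻¹ ≈ y
  ⁻¹-unique {x} {y} x≉0 xy≈1 = begin
    x ⁻¹            ≈⟨ *-identityʳ _ ⟨
    x ⁻¹ * 1#       ≈⟨ *-congˡ xy≈1 ⟨
    x ⁻¹ * (x * y)  ≈⟨ *-assoc _ _ _ ⟨
    (x ⁻¹ * x) * y  ≈⟨ *-congʳ (⁻¹-inverseˡ x≉0) ⟩
    1# * y          ≈⟨ *-identityˡ y ⟩
    y               ∎

  ⁻¹-≉0 : ∀ {x} → x ≉ 0# → x ⁻¹ ≉ 0#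
  ⁻¹-≉0 {x} x≉0 x⁻¹≈0 = 1≉0 (begin
    1#          ≈⟨ ⁻¹-inverseʳ x≉0 ⟨
    x * x ⁻¹    ≈⟨ *-congˡ x⁻¹≈0 ⟩
    x * 0#      ≈⟨ zeroʳ x ⟩
    0#          ∎)

  ⁻¹-distrib-* : ∀ {x y} → x ≉ 0# → y ≉ 0# → (x * y) ⁻¹ ≈ x ⁻¹ * y ⁻¹
  ⁻¹-distrib-* {x} {y} x≉0 y≉0 = ⁻¹-unique (*-≉0 x≉0 y≉0) (begin
    (x * y) * (x ⁻¹ * y ⁻¹)    ≈⟨ *-interchange x y (x ⁻¹) (y ⁻¹) ⟩
    (x * x ⁻¹) * (y * y ⁻¹)    ≈⟨ *-cong (⁻¹-inverseʳ x≉0) (⁻¹-inverseʳ y≉0) ⟩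
    1# * 1#                    ≈⟨ *-identityˡ 1# ⟩
    1#                         ∎)

  ^-congˡ : ∀ {x y} n → x ≈ y → x ^ n ≈ y ^ n
  ^-congˡ zero _ = refl
  ^-congˡ (suc n) x≈y = *-cong x≈y (^-congˡ n x≈y)

  ^-≉0 : ∀ {x} n → x ≉ 0# → x ^ n ≉ 0#
  ^-≉0 zero _ = 1≉0
  ^-≉0 (suc n) x≉0 = *-≉0 x≉0 (^-≉0 n x≉0)

  ^-homo-* : ∀ x m n → x ^ (m ℕ.+ n) ≈ x ^ m * x ^ n
  ^-homo-* x zero n = sym (*-identityˡ _)
  ^-homo-* x (suc m) n = trans (*-congˡ (^-homo-* x m n)) (sym (*-assoc _ _ _))

  ^-distrib-* : ∀ x y n → (x * y) ^ n ≈ x ^ n * y ^ n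
  ^-distrib-* x y zero = sym (*-identityˡ 1#)
  ^-distrib-* x y (suc n) = trans (*-congˡ (^-distrib-* x y n)) (*-interchange x y (x ^ n) (y ^ n))

  ^-assocʳ : ∀ x m n → (x ^ m) ^ n ≈ x ^ (m ℕ.* n)
  ^-assocʳ x m zero rewrite ℕP.*-zeroʳ m = refl
  ^-assocʳ x m (suc n) rewrite ℕP.*-suc m n = trans (*-congˡ (^-assocʳ x m n)) (sym (^-homo-* x m (m ℕ.* n)))

  x^n≈x*x^[n∸1] : ∀ x {n} → 1 ≤ n → x ^ n ≈ x * x ^ (n ∸ 1)
  x^n≈x*x^[n∸1] x (s≤s _) = refl

  1^n≈1 : ∀ n → 1# ^ n ≈ 1#
  1^n≈1 zero = refl
  1^n≈1 (suc n) = trans (*-identityˡ _) (1^n≈1 n)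

  ^-⁻¹-inverseʳ : ∀ {x} n → x ≉ 0# → x ^ n * (x ⁻¹) ^ n ≈ 1#
  ^-⁻¹-inverseʳ {x} n x≉0 = begin
    x ^ n * (x ⁻¹) ^ n   ≈⟨ ^-distrib-* x (x ⁻¹) n ⟨
    (x * x ⁻¹) ^ n       ≈⟨ ^-congˡ n (⁻¹-inverseʳ x≉0) ⟩
    1# ^ n               ≈⟨ 1^n≈1 n ⟩
    1#                   ∎

  ^ℤ-⊖ : ∀ {x} m n → x ≉ 0# → x ^ℤ (m ⊖ n) ≈ x ^ m * (x ⁻¹) ^ n
  ^ℤ-⊖ m zero _ rewrite ℤP.⊖-≥ {m} {0} ℕ.z≤n = sym (*-identityʳ _)
  ^ℤ-⊖ zero (suc n) _ rewrite ℤP.⊖-< {0} {suc n} ℕ.z<s = sym (*-identityˡ _)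
  ^ℤ-⊖ {x} (suc m) (suc n) x≉0 rewrite ℤP.[1+m]⊖[1+n]≡m⊖n m n = begin
    x ^ℤ (m ⊖ n)                                ≈⟨ ^ℤ-⊖ m n x≉0 ⟩
    x ^ m * (x ⁻¹) ^ n                          ≈⟨ *-identityˡ _ ⟨
    1# * (x ^ m * (x ⁻¹) ^ n)                   ≈⟨ *-congʳ (⁻¹-inverseʳ x≉0) ⟨
    (x * x ⁻¹) * (x ^ m * (x ⁻¹) ^ n)           ≈⟨ *-interchange x (x ⁻¹) (x ^ m) ((x ⁻¹) ^ n) ⟩
    (x * x ^ m) * (x ⁻¹ * (x ⁻¹) ^ n)           ∎

  ^ℤ-⊖-≉0 : ∀ {x} m n → x ≉ 0# → x ^ℤ (m ⊖ n) ≉ 0#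
  ^ℤ-⊖-≉0 m n x≉0 = ≉0-resp-≈ (sym (^ℤ-⊖ m n x≉0)) (*-≉0 (^-≉0 m x≉0) (^-≉0 n (⁻¹-≉0 x≉0)))

  ⁻¹-^ℤ-⊖ : ∀ {x} m n → x ≉ 0# → (x ^ℤ (m ⊖ n)) ⁻¹ ≈ (x ⁻¹) ^ m * x ^ n
  ⁻¹-^ℤ-⊖ {x} m n x≉0 = ⁻¹-unique (^ℤ-⊖-≉0 m n x≉0) (begin
    x ^ℤ (m ⊖ n) * ((x ⁻¹) ^ m * x ^ n)          ≈⟨ *-congʳ (^ℤ-⊖ m n x≉0) ⟩
    (x ^ m * (x ⁻¹) ^ n) * ((x ⁻¹) ^ m * x ^ n)  ≈⟨ *-interchange _ _ _ _ ⟩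
    (x ^ m * (x ⁻¹) ^ m) * ((x ⁻¹) ^ n * x ^ n)  ≈⟨ *-cong (^-⁻¹-inverseʳ m x≉0) (trans (*-comm _ _) (^-⁻¹-inverseʳ n x≉0)) ⟩
    1# * 1#                                      ≈⟨ *-identityˡ 1# ⟩
    1#                                           ∎)

module RangeProperties {c ℓ : Level} (F : Field c ℓ) where
  open Field F
  open FieldDefs F
  open FieldProperties F
  open import Relation.Binary.Reasoning.Setoid setoid

  InRange : ℕ → ℕ → ℕ → Set
  InRange lo L j = lo ≤ j × j < lo ℕ.+ L

  InRange-head : ∀ lo L → InRange lo (suc L) lo
  InRange-head lo L = ℕP.≤-refl , ℕP.m<m+n lo ℕ.z<s

  InRange-tail : ∀ {lo L j} → InRange (suc lo) L j → InRange lo (suc L) j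
  InRange-tail {lo} {L} {j} (lo<j , j<) = ℕP.<⇒≤ lo<j , ≡.subst (j <_) (≡.sym (ℕP.+-suc lo L)) j<

  sumFrom-cong : ∀ {f g : ℕ → Carrier} lo L → (∀ j → InRange lo L j → f j ≈ g j) → sumFrom f lo L ≈ sumFrom g lo L
  sumFrom-cong lo zero _ = refl
  sumFrom-cong lo (suc L) f≈g = +-cong (f≈g lo (InRange-head lo L)) (sumFrom-cong (suc lo) L (λ j r → f≈g j (InRange-tail r)))

  prodFrom-cong : ∀ {f g : ℕ → Carrier} lo L → (∀ j → InRange lo L j → f j ≈ g j) → prodFrom f lo L ≈ prodFrom g lo L
  prodFrom-cong lo zero _ = refl
  prodFrom-cong lo (suc L) f≈g = *-cong (f≈g lo (InRange-head lo L)) (prodFrom-cong (suc lo) L (λ j r → f≈g j (InRange-tail r)))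

  *-distribˡ-sumFrom : ∀ k (f : ℕ → Carrier) lo L → k * sumFrom f lo L ≈ sumFrom (λ j → k * f j) lo L
  *-distribˡ-sumFrom k f lo zero = zeroʳ k
  *-distribˡ-sumFrom k f lo (suc L) = trans (distribˡ k _ _) (+-congˡ (*-distribˡ-sumFrom k f (suc lo) L))

  prodFrom-distrib-* : ∀ (f g : ℕ → Carrier) lo L → prodFrom (λ j → f j * g j) lo L ≈ prodFrom f lo L * prodFrom g lo L
  prodFrom-distrib-* f g lo zero = sym (*-identityˡ 1#)
  prodFrom-distrib-* f g lo (suc L) =
    trans (*-congˡ (prodFrom-distrib-* f g (suc lo) L)) (*-interchange (f lo) (g lo) _ _)

  prodFrom-const : ∀ k lo L → prodFrom (λ _ → k) lo L ≈ k ^ L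
  prodFrom-const k lo zero = refl
  prodFrom-const k lo (suc L) = *-congˡ (prodFrom-const k (suc lo) L)

  prodFrom-≉0 : ∀ (f : ℕ → Carrier) lo L → (∀ j → InRange lo L j → f j ≉ 0#) → prodFrom f lo L ≉ 0#
  prodFrom-≉0 f lo zero _ = 1≉0
  prodFrom-≉0 f lo (suc L) f≉0 = *-≉0 (f≉0 lo (InRange-head lo L)) (prodFrom-≉0 f (suc lo) L (λ j r → f≉0 j (InRange-tail r)))

  prodFrom-⁻¹-inverseˡ : ∀ (f : ℕ → Carrier) lo L → (∀ j → InRange lo L j → f j ≉ 0#) →
                         prodFrom (λ j → f j ⁻¹) lo L * prodFrom f lo L ≈ 1#
  prodFrom-⁻¹-inverseˡ f lo L f≉0 = begin
    prodFrom (λ j → f j ⁻¹) lo L * prodFrom f lo L  ≈⟨ prodFrom-distrib-* _ _ lo L ⟨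
    prodFrom (λ j → f j ⁻¹ * f j) lo L              ≈⟨ prodFrom-cong lo L (λ j r → ⁻¹-inverseˡ (f≉0 j r)) ⟩
    prodFrom (λ _ → 1#) lo L                        ≈⟨ prodFrom-const 1# lo L ⟩
    1# ^ L                                          ≈⟨ 1^n≈1 L ⟩
    1#                                              ∎

  prodFrom-⁻¹ : ∀ (f : ℕ → Carrier) lo L → (∀ j → InRange lo L j → f j ≉ 0#) →
                prodFrom (λ j → f j ⁻¹) lo L ≈ (prodFrom f lo L) ⁻¹
  prodFrom-⁻¹ f lo L f≉0 =
    sym (⁻¹-unique (prodFrom-≉0 f lo L f≉0) (trans (*-comm _ _) (prodFrom-⁻¹-inverseˡ f lo L f≉0)))

  prodFrom-++ : ∀ (f : ℕ → Carrier) lo L₁ L₂ → prodFrom f lo (L₁ ℕ.+ L₂) ≈ prodFrom f lo L₁ * prodFrom f (lo ℕ.+ L₁) L₂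
  prodFrom-++ f lo zero L₂ rewrite ℕP.+-identityʳ lo = sym (*-identityˡ _)
  prodFrom-++ f lo (suc L₁) L₂ rewrite ℕP.+-suc lo L₁ =
    trans (*-congˡ (prodFrom-++ f (suc lo) L₁ L₂)) (sym (*-assoc _ _ _))

  prodFrom-snoc : ∀ (f : ℕ → Carrier) lo L → prodFrom f lo (suc L) ≈ prodFrom f lo L * f (lo ℕ.+ L)
  prodFrom-snoc f lo L = begin
    prodFrom f lo (suc L)                   ≡⟨ ≡.cong (prodFrom f lo) (ℕP.+-comm 1 L) ⟩
    prodFrom f lo (L ℕ.+ 1)                 ≈⟨ prodFrom-++ f lo L 1 ⟩
    prodFrom f lo L * (f (lo ℕ.+ L) * 1#)   ≈⟨ *-congˡ (*-identityʳ _) ⟩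
    prodFrom f lo L * f (lo ℕ.+ L)          ∎

  prodFrom-shift : ∀ (f : ℕ → Carrier) lo L → prodFrom f (suc lo) L ≡ prodFrom (λ j → f (suc j)) lo L
  prodFrom-shift f lo zero = ≡.refl
  prodFrom-shift f lo (suc L) = ≡.cong (f (suc lo) *_) (prodFrom-shift f (suc lo) L)

module DividedDifferences {c ℓ : Level} (F : Field c ℓ) where
  open Field F
  open FieldDefs F
  open FieldProperties F
  open import Algebra.Properties.Ring ring using (-1*x≈-x)
  open import Relation.Binary.Reasoning.Setoid setoid

  invDiffProd : Carrier → List Carrier → Carrier
  invDiffProd x [] = 1#
  invDiffProd x (y ∷ ys) = (x - y) ⁻¹ * invDiffProd x ys

  -- divDiff f [x₁, …, xₙ] = Σᵢ f xᵢ / Πⱼ≠ᵢ (xᵢ - xⱼ), the Lagrange form of the divided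
  -- difference; removing x₁ moves the factors (xᵢ - x₁)⁻¹ into f.
  divDiff : (Carrier → Carrier) → List Carrier → Carrier
  divDiff f [] = 0#
  divDiff f (x ∷ xs) = f x * invDiffProd x xs + divDiff (λ u → f u * (u - x) ⁻¹) xs

  divDiff-cong-on : ∀ {f g} xs → All (λ u → f u ≈ g u) xs → divDiff f xs ≈ divDiff g xs
  divDiff-cong-on [] _ = refl
  divDiff-cong-on (x ∷ xs) (fx≈gx ∷ f≈g) =
    +-cong (*-congʳ fx≈gx) (divDiff-cong-on xs (All.map *-congʳ f≈g))

  divDiff-cong : ∀ {f g} xs → (∀ u → f u ≈ g u) → divDiff f xs ≈ divDiff g xs
  divDiff-cong xs f≈g = divDiff-cong-on xs (All.tabulate (λ {u} _ → f≈g u))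

  divDiff-+ : ∀ f g xs → divDiff (λ u → f u + g u) xs ≈ divDiff f xs + divDiff g xs
  divDiff-+ f g [] = sym (+-identityˡ 0#)
  divDiff-+ f g (x ∷ xs) = begin
    (f x + g x) * p + divDiff (λ u → (f u + g u) * (u - x) ⁻¹) xs
      ≈⟨ +-cong (distribʳ p (f x) (g x)) (divDiff-cong xs (λ u → distribʳ _ _ _)) ⟩
    (f x * p + g x * p) + divDiff (λ u → f u * (u - x) ⁻¹ + g u * (u - x) ⁻¹) xs
      ≈⟨ +-congˡ (divDiff-+ (λ u → f u * (u - x) ⁻¹) (λ u → g u * (u - x) ⁻¹) xs) ⟩
    (f x * p + g x * p) + (divDiff (λ u → f u * (u - x) ⁻¹) xs + divDiff (λ u → g u * (u - x) ⁻¹) xs)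
      ≈⟨ +-interchange _ _ _ _ ⟩
    divDiff f (x ∷ xs) + divDiff g (x ∷ xs) ∎
    where p = invDiffProd x xs

  divDiff-*ˡ : ∀ k f xs → divDiff (λ u → k * f u) xs ≈ k * divDiff f xs
  divDiff-*ˡ k f [] = sym (zeroʳ k)
  divDiff-*ˡ k f (x ∷ xs) = begin
    (k * f x) * p + divDiff (λ u → (k * f u) * (u - x) ⁻¹) xs
      ≈⟨ +-cong (*-assoc k (f x) p) (divDiff-cong xs (λ u → *-assoc _ _ _)) ⟩
    k * (f x * p) + divDiff (λ u → k * (f u * (u - x) ⁻¹)) xs
      ≈⟨ +-congˡ (divDiff-*ˡ k (λ u → f u * (u - x) ⁻¹) xs) ⟩
    k * (f x * p) + k * divDiff (λ u → f u * (u - x) ⁻¹) xs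
      ≈⟨ distribˡ k _ _ ⟨
    k * divDiff f (x ∷ xs) ∎
    where p = invDiffProd x xs

  divDiff-sub : ∀ f g xs → divDiff (λ u → f u - g u) xs ≈ divDiff f xs - divDiff g xs
  divDiff-sub f g xs = begin
    divDiff (λ u → f u - g u) xs                ≈⟨ divDiff-cong xs (λ u → +-congˡ (-1*x≈-x (g u))) ⟨
    divDiff (λ u → f u + - 1# * g u) xs         ≈⟨ divDiff-+ f _ xs ⟩
    divDiff f xs + divDiff (λ u → - 1# * g u) xs ≈⟨ +-congˡ (trans (divDiff-*ˡ (- 1#) g xs) (-1*x≈-x _)) ⟩
    divDiff f xs - divDiff g xs                 ∎

  divDiff-cancel-node : ∀ f x T → All (λ y → y - x ≉ 0#) T →
                        divDiff (λ u → (u - x) * f u) (x ∷ T) ≈ divDiff f T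
  divDiff-cancel-node f x T T-x≉0 = begin
    (x - x) * f x * invDiffProd x T + divDiff (λ u → ((u - x) * f u) * (u - x) ⁻¹) T
      ≈⟨ +-cong vanishes (divDiff-cong-on T (All.map cancel T-x≉0)) ⟩
    0# + divDiff f T ≈⟨ +-identityˡ _ ⟩
    divDiff f T ∎
    where
    vanishes : (x - x) * f x * invDiffProd x T ≈ 0#
    vanishes = trans (*-congʳ (trans (*-congʳ (-‿inverseʳ x)) (zeroˡ _))) (zeroˡ _)
    cancel : ∀ {u} → u - x ≉ 0# → ((u - x) * f u) * (u - x) ⁻¹ ≈ f u
    cancel {u} u-x≉0 = begin
      ((u - x) * f u) * (u - x) ⁻¹  ≈⟨ *-congʳ (*-comm _ _) ⟩
      (f u * (u - x)) * (u - x) ⁻¹  ≈⟨ *-assoc _ _ _ ⟩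
      f u * ((u - x) * (u - x) ⁻¹)  ≈⟨ *-congˡ (⁻¹-inverseʳ u-x≉0) ⟩
      f u * 1#                      ≈⟨ *-identityʳ _ ⟩
      f u                           ∎

  divDiff-swap : ∀ f x y T → divDiff f (x ∷ y ∷ T) ≈ divDiff f (y ∷ x ∷ T)
  divDiff-swap f x y T = begin
    f x * (dxy * px) + ((f y * dyx) * py + divDiff (λ u → (f u * (u - x) ⁻¹) * (u - y) ⁻¹) T)
      ≈⟨ +-congˡ (+-congˡ (divDiff-cong T (λ u → xy*z≈xz*y (f u) _ _))) ⟩
    f x * (dxy * px) + ((f y * dyx) * py + divDiff (λ u → (f u * (u - y) ⁻¹) * (u - x) ⁻¹) T)
      ≈⟨ solve 7 (λ a b p q r s d → a :* (p :* r) :+ ((b :* q) :* s :+ d) := b :* (q :* s) :+ ((a :* p) :* r :+ d))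
           refl (f x) (f y) dxy dyx px py _ ⟩
    f y * (dyx * py) + ((f x * dxy) * px + divDiff (λ u → (f u * (u - y) ⁻¹) * (u - x) ⁻¹) T) ∎
    where
    dxy = (x - y) ⁻¹
    dyx = (y - x) ⁻¹
    px = invDiffProd x T
    py = invDiffProd y T

  data Distinct : List Carrier → Set (c ⊔ ℓ) where
    [] : Distinct []
    _∷_ : ∀ {x xs} → All (λ y → y - x ≉ 0#) xs → Distinct xs → Distinct (x ∷ xs)

  divDiff-recurrence : ∀ f x₀ x₁ T → Distinct (x₀ ∷ x₁ ∷ T) →
    (x₁ - x₀) * divDiff f (x₀ ∷ x₁ ∷ T) ≈ divDiff f (x₁ ∷ T) - divDiff f (x₀ ∷ T)
  divDiff-recurrence f x₀ x₁ T ((x₁-x₀≉0 ∷ T-x₀≉0) ∷ (T-x₁≉0 ∷ _)) = begin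
    (x₁ - x₀) * divDiff f S
      ≈⟨ divDiff-*ˡ (x₁ - x₀) f S ⟨
    divDiff (λ u → (x₁ - x₀) * f u) S
      ≈⟨ divDiff-cong S (λ u → solve 4 (λ u a b v → (b :- a) :* v := (u :- a) :* v :- (u :- b) :* v) refl u x₀ x₁ (f u)) ⟩
    divDiff (λ u → (u - x₀) * f u - (u - x₁) * f u) S
      ≈⟨ divDiff-sub _ _ S ⟩
    divDiff (λ u → (u - x₀) * f u) S - divDiff (λ u → (u - x₁) * f u) S
      ≈⟨ +-cong (divDiff-cancel-node f x₀ (x₁ ∷ T) (x₁-x₀≉0 ∷ T-x₀≉0))
                (-‿cong (trans (divDiff-swap _ x₀ x₁ T)
                               (divDiff-cancel-node f x₁ (x₀ ∷ T) (x-y≉0⇒y-x≉0 x₁-x₀≉0 ∷ T-x₁≉0)))) ⟩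
    divDiff f (x₁ ∷ T) - divDiff f (x₀ ∷ T) ∎
    where S = x₀ ∷ x₁ ∷ T

  divDiff-1≈0 : ∀ x₀ x₁ T → Distinct (x₀ ∷ x₁ ∷ T) → divDiff (λ _ → 1#) (x₀ ∷ x₁ ∷ T) ≈ 0#
  divDiff-1≈0 x₀ x₁ T S-distinct@((x₁-x₀≉0 ∷ _) ∷ _) =
    x*y≈0⇒y≈0 x₁-x₀≉0 (trans (divDiff-recurrence (λ _ → 1#) x₀ x₁ T S-distinct) (difference T S-distinct))
    where
    difference : ∀ T → Distinct (x₀ ∷ x₁ ∷ T) → divDiff (λ _ → 1#) (x₁ ∷ T) - divDiff (λ _ → 1#) (x₀ ∷ T) ≈ 0#
    difference [] _ = -‿inverseʳ _
    difference (y ∷ T) ((_ ∷ y-x₀≉0 ∷ T-x₀≉0) ∷ T₁-distinct) = begin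
      divDiff (λ _ → 1#) (x₁ ∷ y ∷ T) - divDiff (λ _ → 1#) (x₀ ∷ y ∷ T)
        ≈⟨ +-cong (divDiff-1≈0 x₁ y T T₁-distinct) (-‿cong (divDiff-1≈0 x₀ y T ((y-x₀≉0 ∷ T-x₀≉0) ∷ tail T₁-distinct))) ⟩
      0# - 0# ≈⟨ -‿inverseʳ 0# ⟩
      0# ∎
      where
      tail : ∀ {x xs} → Distinct (x ∷ xs) → Distinct xs
      tail (_ ∷ d) = d

  h : ℕ → List Carrier → Carrier
  h zero _ = 1#
  h (suc k) [] = 0#
  h (suc k) (x ∷ xs) = x * h k (x ∷ xs) + h (suc k) xs

  hℤ : ℤ → List Carrier → Carrier
  hℤ (+ k) xs = h k xs
  hℤ -[1+ _ ] xs = 0#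

  hℤ-recurrence : ∀ x T p r → hℤ (suc p ⊖ r) (x ∷ T) ≈ hℤ (suc p ⊖ r) T + x * hℤ (p ⊖ r) (x ∷ T)
  hℤ-recurrence x T p zero rewrite ℤP.⊖-≥ {suc p} {0} ℕ.z≤n | ℤP.⊖-≥ {p} {0} ℕ.z≤n = +-comm _ _
  hℤ-recurrence x T p (suc r) rewrite ℤP.[1+m]⊖[1+n]≡m⊖n p r = shifted p r
    where
    shifted : ∀ p r → hℤ (p ⊖ r) (x ∷ T) ≈ hℤ (p ⊖ r) T + x * hℤ (p ⊖ suc r) (x ∷ T)
    shifted zero zero = trans (sym (+-identityʳ 1#)) (+-congˡ (sym (zeroʳ x)))
    shifted zero (suc r) = trans (sym (+-identityʳ 0#)) (+-congˡ (sym (zeroʳ x)))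
    shifted (suc p) r rewrite ℤP.[1+m]⊖[1+n]≡m⊖n p r = hℤ-recurrence x T p r

  -- uᵐ⁺¹ = (u - x) uᵐ + x uᵐ, and the factor u - x removes the node x.
  divDiff-^ : ∀ m S → Distinct S → divDiff (_^ m) S ≈ hℤ (suc m ⊖ length S) S
  divDiff-^ zero [] _ = refl
  divDiff-^ zero (x ∷ []) _ = trans (+-identityʳ _) (*-identityˡ _)
  divDiff-^ zero (x₀ ∷ x₁ ∷ T) S-distinct = divDiff-1≈0 x₀ x₁ T S-distinct
  divDiff-^ (suc m) [] _ = refl
  divDiff-^ (suc m) (x ∷ T) S-distinct@(T-x≉0 ∷ T-distinct) = begin
    divDiff (_^ suc m) (x ∷ T)
      ≈⟨ divDiff-cong (x ∷ T) (λ u → solve 3 (λ u x p → u :* p := (u :- x) :* p :+ x :* p) refl u x (u ^ m)) ⟩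
    divDiff (λ u → (u - x) * u ^ m + x * u ^ m) (x ∷ T)
      ≈⟨ divDiff-+ _ _ (x ∷ T) ⟩
    divDiff (λ u → (u - x) * u ^ m) (x ∷ T) + divDiff (λ u → x * u ^ m) (x ∷ T)
      ≈⟨ +-cong (divDiff-cancel-node (_^ m) x T T-x≉0) (divDiff-*ˡ x (_^ m) (x ∷ T)) ⟩
    divDiff (_^ m) T + x * divDiff (_^ m) (x ∷ T)
      ≈⟨ +-cong (divDiff-^ m T T-distinct) (*-congˡ (divDiff-^ m (x ∷ T) S-distinct)) ⟩
    hℤ (suc m ⊖ length T) T + x * hℤ (suc m ⊖ suc (length T)) (x ∷ T)
      ≡⟨ ≡.cong (λ t → hℤ (suc m ⊖ length T) T + x * hℤ t (x ∷ T)) (ℤP.[1+m]⊖[1+n]≡m⊖n m (length T)) ⟩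
    hℤ (suc m ⊖ length T) T + x * hℤ (m ⊖ length T) (x ∷ T)
      ≈⟨ hℤ-recurrence x T m (length T) ⟨
    hℤ (suc m ⊖ length T) (x ∷ T)
      ≡⟨ ≡.cong (λ t → hℤ t (x ∷ T)) (ℤP.[1+m]⊖[1+n]≡m⊖n (suc m) (length T)) ⟨
    hℤ (suc (suc m) ⊖ suc (length T)) (x ∷ T) ∎

module Nodes {c ℓ : Level} (F : Field c ℓ) (x : ℕ → Field.Carrier F) where
  open Field F
  open FieldDefs F
  open RangeProperties F
  open DividedDifferences F
  open import Relation.Binary.Reasoning.Setoid setoid

  nodes : ℕ → ℕ → List Carrier
  nodes lo zero = []
  nodes lo (suc L) = x lo ∷ nodes (suc lo) L

  length-nodes : ∀ lo L → length (nodes lo L) ≡ L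
  length-nodes lo zero = ≡.refl
  length-nodes lo (suc L) = ≡.cong suc (length-nodes (suc lo) L)

  incSeqSum≈h : ∀ n k lo L → lo ℕ.+ L ≡ suc n → incSeqSum n x k lo ≈ h k (nodes lo L)
  incSeqSum≈h n zero lo L _ = refl
  incSeqSum≈h n (suc k) lo L lo+L≡1+n = begin
    sumFrom f lo (suc n ∸ lo)  ≡⟨ ≡.cong (sumFrom f lo) (≡.trans (≡.cong (_∸ lo) (≡.sym lo+L≡1+n)) (ℕP.m+n∸m≡n lo L)) ⟩
    sumFrom f lo L             ≈⟨ tails lo L lo+L≡1+n ⟩
    h (suc k) (nodes lo L)     ∎
    where
    f : ℕ → Carrier
    f i = x i * incSeqSum n x k i
    tails : ∀ lo L → lo ℕ.+ L ≡ suc n → sumFrom f lo L ≈ h (suc k) (nodes lo L)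
    tails lo zero _ = refl
    tails lo (suc L) lo+L≡1+n = +-cong (*-congˡ (incSeqSum≈h n k lo (suc L) lo+L≡1+n))
                                      (tails (suc lo) L (≡.trans (≡.sym (ℕP.+-suc lo L)) lo+L≡1+n))

  hSum≈hℤ : ∀ n t → hSum n x t ≈ hℤ t (nodes 1 n)
  hSum≈hℤ n (+ k) = incSeqSum≈h n k 1 n ≡.refl
  hSum≈hℤ n -[1+ k ] = refl

  All-nodes : ∀ {p} {P : Carrier → Set p} lo L → (∀ i → InRange lo L i → P (x i)) → All P (nodes lo L)
  All-nodes lo zero _ = []
  All-nodes lo (suc L) P-x = P-x lo (InRange-head lo L) ∷ All-nodes (suc lo) L (λ i r → P-x i (InRange-tail r))

  invDiffProd-nodes : ∀ u lo L → invDiffProd u (nodes lo L) ≡ prodFrom (λ j → (u - x j) ⁻¹) lo L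
  invDiffProd-nodes u lo zero = ≡.refl
  invDiffProd-nodes u lo (suc L) = ≡.cong ((u - x lo) ⁻¹ *_) (invDiffProd-nodes u (suc lo) L)

  lagrangeWeight : ℕ → ℕ → Carrier
  lagrangeWeight n i = prodFrom (λ j → (x i - x j) ⁻¹) 1 (i ∸ 1) * prodFrom (λ j → (x i - x j) ⁻¹) (suc i) (n ∸ i)

  divDiff-nodes-from : ∀ n (f : Carrier → Carrier) p L → p ℕ.+ L ≡ n →
    divDiff (λ u → f u * prodFrom (λ j → (u - x j) ⁻¹) 1 p) (nodes (suc p) L)
      ≈ sumFrom (λ i → f (x i) * lagrangeWeight n i) (suc p) L
  divDiff-nodes-from n f p zero _ = refl
  divDiff-nodes-from n f p (suc L) p+L≡n = +-cong head tail
    where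
    i : ℕ
    i = suc p
    i+L≡n : i ℕ.+ L ≡ n
    i+L≡n = ≡.trans (≡.sym (ℕP.+-suc p L)) p+L≡n
    n∸i≡L : n ∸ i ≡ L
    n∸i≡L = ≡.trans (≡.cong (_∸ i) (≡.sym i+L≡n)) (ℕP.m+n∸m≡n i L)
    head : (f (x i) * prodFrom (λ j → (x i - x j) ⁻¹) 1 p) * invDiffProd (x i) (nodes (suc i) L)
           ≈ f (x i) * lagrangeWeight n i
    head rewrite invDiffProd-nodes (x i) (suc i) L | n∸i≡L = *-assoc _ _ _
    absorb : ∀ u → (f u * prodFrom (λ j → (u - x j) ⁻¹) 1 p) * (u - x i) ⁻¹
                   ≈ f u * prodFrom (λ j → (u - x j) ⁻¹) 1 i
    absorb u = trans (*-assoc _ _ _) (*-congˡ (sym (prodFrom-snoc (λ j → (u - x j) ⁻¹) 1 p)))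
    tail : divDiff (λ u → (f u * prodFrom (λ j → (u - x j) ⁻¹) 1 p) * (u - x i) ⁻¹) (nodes (suc i) L)
           ≈ sumFrom (λ i → f (x i) * lagrangeWeight n i) (suc i) L
    tail = trans (divDiff-cong (nodes (suc i) L) absorb) (divDiff-nodes-from n f i L i+L≡n)

  divDiff-nodes : ∀ n (f : Carrier → Carrier) → divDiff f (nodes 1 n) ≈ sumFrom (λ i → f (x i) * lagrangeWeight n i) 1 n
  divDiff-nodes n f = trans (divDiff-cong (nodes 1 n) (λ u → sym (*-identityʳ (f u)))) (divDiff-nodes-from n f 0 n ≡.refl)

module BinomialExponents where
  open import Data.Nat using (_+_; _*_)
  open import Data.Nat.Combinatorics using (_C_; nCk+nC[k+1]≡[n+1]C[k+1]; nC1≡n)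
  open import Data.Nat.Tactic.RingSolver using (solve-∀)
  open ≡.≡-Reasoning

  [1+n]C2≡n+nC2 : ∀ n → suc n C 2 ≡ n + n C 2
  [1+n]C2≡n+nC2 n = ≡.trans (≡.sym (nCk+nC[k+1]≡[n+1]C[k+1] n 1)) (≡.cong (_+ n C 2) (nC1≡n n))

  [1+n]C2+nC2≡n*n : ∀ n → suc n C 2 + n C 2 ≡ n * n
  [1+n]C2+nC2≡n*n zero = ≡.refl
  [1+n]C2+nC2≡n*n (suc n) = begin
    suc (suc n) C 2 + suc n C 2        ≡⟨ ≡.cong₂ _+_ ([1+n]C2≡n+nC2 (suc n)) ([1+n]C2≡n+nC2 n) ⟩
    (suc n + suc n C 2) + (n + n C 2)  ≡⟨ regroup n (suc n C 2) (n C 2) ⟩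
    suc n + n + (suc n C 2 + n C 2)    ≡⟨ ≡.cong (λ s → suc n + n + s) ([1+n]C2+nC2≡n*n n) ⟩
    suc n + n + n * n                  ≡⟨ square n ⟩
    suc n * suc n                      ∎
    where
    regroup : ∀ n a b → (suc n + a) + (n + b) ≡ suc n + n + (a + b)
    regroup = solve-∀
    square : ∀ n → suc n + n + n * n ≡ suc n * suc n
    square = solve-∀

  [1+i]C2+iC2+i*[n∸i]≡n*i : ∀ i n → i ≤ n → (suc i C 2 + i C 2) + i * (n ∸ i) ≡ n * i
  [1+i]C2+iC2+i*[n∸i]≡n*i i n i≤n = begin
    (suc i C 2 + i C 2) + i * (n ∸ i)  ≡⟨ ≡.cong (_+ i * (n ∸ i)) ([1+n]C2+nC2≡n*n i) ⟩
    i * i + i * (n ∸ i)                ≡⟨ ℕP.*-distribˡ-+ i i (n ∸ i) ⟨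
    i * (i + (n ∸ i))                  ≡⟨ ≡.cong (i *_) (ℕP.m+[n∸m]≡n i≤n) ⟩
    i * n                              ≡⟨ ℕP.*-comm i n ⟩
    n * i                              ∎

module QProducts {c ℓ : Level} (F : Field c ℓ) (q : Field.Carrier F) where
  open Field F
  open FieldDefs F
  open FieldProperties F
  open RangeProperties F
  open import Algebra.Properties.Ring ring using (x[y-z]≈xy-xz)
  open import Data.Nat.Combinatorics using (_C_)
  open import Relation.Binary.Reasoning.Setoid setoid

  prod-below : ∀ k → prodFrom (λ j → q ^ suc k - q ^ j) 1 k * (- 1#) ^ k ≈ q ^ (suc k C 2) * qPoch q q k
  prod-below zero = refl
  prod-below (suc k) = begin
    prodFrom (λ j → q ^ suc (suc k) - q ^ j) 1 (suc k) * (- 1#) ^ suc k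
      ≡⟨ ≡.cong (_* (- 1#) ^ suc k) (prodFrom-shift (λ j → q ^ suc (suc k) - q ^ j) 0 (suc k)) ⟩
    ((q * (q * t) - q * 1#) * prodFrom (λ j → q * (q * t) - q * q ^ j) 1 k) * (- 1#) ^ suc k
      ≈⟨ *-congʳ (*-congˡ (prodFrom-cong 1 k (λ j _ → sym (x[y-z]≈xy-xz q (q * t) (q ^ j))))) ⟩
    ((q * (q * t) - q * 1#) * prodFrom (λ j → q * (q * t - q ^ j)) 1 k) * (- 1#) ^ suc k
      ≈⟨ *-congʳ (*-congˡ (trans (prodFrom-distrib-* (λ _ → q) (λ j → q * t - q ^ j) 1 k) (*-congʳ (prodFrom-const q 1 k)))) ⟩
    ((q * (q * t) - q * 1#) * (t * below)) * ((- 1#) * (- 1#) ^ k)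
      ≈⟨ solve 4 (λ q t p s → ((q :* (q :* t) :- q :* con (+ 1)) :* (t :* p)) :* (:- con (+ 1) :* s)
                              := ((q :* t) :* (con (+ 1) :- q :* t)) :* (p :* s)) refl q t below ((- 1#) ^ k) ⟩
    ((q * t) * (1# - q * t)) * (below * (- 1#) ^ k)
      ≈⟨ *-congˡ (prod-below k) ⟩
    ((q * t) * (1# - q * t)) * (q ^ (suc k C 2) * qPoch q q k)
      ≈⟨ *-interchange (q * t) (1# - q * t) _ _ ⟩
    ((q * t) * q ^ (suc k C 2)) * ((1# - q * t) * qPoch q q k)
      ≈⟨ *-cong (sym (^-homo-* q (suc k) (suc k C 2))) (trans (*-comm _ _) (sym (prodFrom-snoc (λ j → 1# - q * q ^ j) 0 k))) ⟩
    q ^ (suc k ℕ.+ suc k C 2) * qPoch q q (suc k)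
      ≡⟨ ≡.cong (λ e → q ^ e * qPoch q q (suc k)) (BinomialExponents.[1+n]C2≡n+nC2 (suc k)) ⟨
    q ^ (suc (suc k) C 2) * qPoch q q (suc k) ∎
    where
    t = q ^ k
    below = prodFrom (λ j → q ^ suc k - q ^ j) 1 k

  prod-above-from : ∀ i k L → prodFrom (λ j → q ^ i - q ^ j) (suc (i ℕ.+ k)) L
                              ≈ (q ^ i) ^ L * prodFrom (λ j → 1# - q * q ^ j) k L
  prod-above-from i k zero = sym (*-identityˡ 1#)
  prod-above-from i k (suc L) = begin
    (q ^ i - q * q ^ (i ℕ.+ k)) * prodFrom f (suc (suc (i ℕ.+ k))) L
      ≡⟨ ≡.cong (λ e → (q ^ i - q * q ^ (i ℕ.+ k)) * prodFrom f (suc e) L) (ℕP.+-suc i k) ⟨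
    (q ^ i - q * q ^ (i ℕ.+ k)) * prodFrom f (suc (i ℕ.+ suc k)) L
      ≈⟨ *-cong (+-congˡ (-‿cong (*-congˡ (^-homo-* q i k)))) (prod-above-from i (suc k) L) ⟩
    (q ^ i - q * (q ^ i * q ^ k)) * ((q ^ i) ^ L * rest)
      ≈⟨ solve 5 (λ a q b c r → (a :- q :* (a :* b)) :* (c :* r) := (a :* c) :* ((con (+ 1) :- q :* b) :* r))
           refl (q ^ i) q (q ^ k) ((q ^ i) ^ L) rest ⟩
    (q ^ i * (q ^ i) ^ L) * ((1# - q * q ^ k) * rest) ∎
    where
    f = λ j → q ^ i - q ^ j
    rest = prodFrom (λ j → 1# - q * q ^ j) (suc k) L

  prod-above : ∀ i L → prodFrom (λ j → q ^ i - q ^ j) (suc i) L ≈ (q ^ i) ^ L * qPoch q q L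
  prod-above i L = trans (reflexive (≡.cong (λ e → prodFrom (λ j → q ^ i - q ^ j) (suc e) L) (≡.sym (ℕP.+-identityʳ i))))
                         (prod-above-from i 0 L)

module Proposition1 {ℓ₁ ℓ₂ : Level} (F : Field ℓ₁ ℓ₂) where
  open Field F
  open FieldDefs F
  open FieldProperties F
  open RangeProperties F
  open DividedDifferences F
  open import Data.Nat.Combinatorics using (_C_)
  open import Relation.Binary.Reasoning.Setoid setoid

  tau≡1+m⊖n : ∀ m n → tau m n ≡ suc m ⊖ n
  tau≡1+m⊖n m n = ≡.trans (≡.cong (ℤ._+ + 1) (ℤP.[+m]-[+n]≡m⊖n m n))
                          (≡.trans (ℤP.distribˡ-⊖-+-pos 1 m n) (≡.cong (_⊖ n) (ℕP.+-comm m 1)))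

  tau+1≡2+m⊖n : ∀ m n → tau m n ℤ.+ + 1 ≡ suc (suc m) ⊖ n
  tau+1≡2+m⊖n m n = ≡.trans (≡.cong (ℤ._+ + 1) (tau≡1+m⊖n m n))
                            (≡.trans (ℤP.distribˡ-⊖-+-pos 1 (suc m) n) (≡.cong (_⊖ n) (ℕP.+-comm (suc m) 1)))

  tau-n-n≡1 : ∀ n → tau n n ≡ + 1
  tau-n-n≡1 n = ≡.trans (tau≡1+m⊖n n n) (≡.trans (ℤP.⊖-≥ (ℕP.n≤1+n n)) (≡.cong +_ (ℕP.m+n∸n≡m 1 n)))

  module Instance (a b c z q : Carrier) (n : ℕ)
    (q≉0 : q ≉ 0#) (c≉0 : c ≉ 0#) (κ≉0 : a * z - b * c ≉ 0#)
    (1-q^j≉0 : ∀ j → 1 ≤ j → j ≤ n → 1# - q ^ j ≉ 0#)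
    (den≉0 : ∀ j → 1 ≤ j → j ≤ n → c - z * q ^ j ≉ 0#) where

    open QProducts F q
    open Nodes F (ratio a b c z q)

    x num den : ℕ → Carrier
    x = ratio a b c z q
    num j = a - b * q ^ j
    den j = c - z * q ^ j

    κ : Carrier
    κ = a * z - b * c

    ratio-difference : ∀ i j → den i ≉ 0# → den j ≉ 0# → x i - x j ≈ κ * (q ^ i - q ^ j) * den i ⁻¹ * den j ⁻¹
    ratio-difference i j den-i≉0 den-j≉0 = begin
      num i * d - num j * e                         ≈⟨ +-cong (*-identityʳ _) (-‿cong (*-identityʳ _)) ⟨
      (num i * d) * 1# - (num j * e) * 1#           ≈⟨ +-cong (*-congˡ (⁻¹-inverseʳ den-j≉0)) (-‿cong (*-congˡ (⁻¹-inverseʳ den-i≉0))) ⟨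
      (num i * d) * (den j * e) - (num j * e) * (den i * d)
        ≈⟨ solve 8 (λ a b c z qi qj d e →
             ((a :- b :* qi) :* d) :* ((c :- z :* qj) :* e) :- ((a :- b :* qj) :* e) :* ((c :- z :* qi) :* d)
             := (a :* z :- b :* c) :* (qi :- qj) :* d :* e) refl a b c z (q ^ i) (q ^ j) d e ⟩
      κ * (q ^ i - q ^ j) * d * e                   ∎
      where
      d = den i ⁻¹
      e = den j ⁻¹

    q^[j+d]-q^j≉0 : ∀ j d → 1 ≤ d → d ≤ n → q ^ (j ℕ.+ d) - q ^ j ≉ 0#
    q^[j+d]-q^j≉0 j d 1≤d d≤n = ≉0-resp-≈ (sym factored) (-‿≉0 (*-≉0 (^-≉0 j q≉0) (1-q^j≉0 d 1≤d d≤n)))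
      where
      factored : q ^ (j ℕ.+ d) - q ^ j ≈ - (q ^ j * (1# - q ^ d))
      factored = trans (+-congʳ (^-homo-* q j d))
                       (solve 2 (λ a b → a :* b :- a := :- (a :* (con (+ 1) :- b))) refl (q ^ j) (q ^ d))

    x-difference-≉0 : ∀ {i j} → 1 ≤ j → j < i → i ≤ n → x i - x j ≉ 0#
    x-difference-≉0 {i} {j} 1≤j j<i i≤n = ≉0-resp-≈ (sym (ratio-difference i j den-i≉0 den-j≉0))
      (*-≉0 (*-≉0 (*-≉0 κ≉0 q^i-q^j≉0) (⁻¹-≉0 den-i≉0)) (⁻¹-≉0 den-j≉0))
      where
      den-i≉0 : den i ≉ 0#
      den-i≉0 = den≉0 i (ℕP.≤-trans 1≤j (ℕP.<⇒≤ j<i)) i≤n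
      den-j≉0 : den j ≉ 0#
      den-j≉0 = den≉0 j 1≤j (ℕP.≤-trans (ℕP.<⇒≤ j<i) i≤n)
      q^i-q^j≉0 : q ^ i - q ^ j ≉ 0#
      q^i-q^j≉0 = ≡.subst (λ t → q ^ t - q ^ j ≉ 0#) (ℕP.m+[n∸m]≡n (ℕP.<⇒≤ j<i))
        (q^[j+d]-q^j≉0 j (i ∸ j) (ℕP.m<n⇒0<n∸m j<i) (ℕP.≤-trans (ℕP.m∸n≤m i j) i≤n))

    Distinct-nodes : ∀ lo L → 1 ≤ lo → lo ℕ.+ L ≤ suc n → Distinct (nodes lo L)
    Distinct-nodes lo zero _ _ = []
    Distinct-nodes lo (suc L) 1≤lo lo+[1+L]≤1+n =
      All-nodes (suc lo) L (λ i (lo<i , i<) → x-difference-≉0 1≤lo lo<i (ℕP.≤-pred (ℕP.≤-trans i< 1+lo+L≤1+n)))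
      ∷ Distinct-nodes (suc lo) L (ℕP.≤-trans 1≤lo (ℕP.n≤1+n lo)) 1+lo+L≤1+n
      where
      1+lo+L≤1+n : suc lo ℕ.+ L ≤ suc n
      1+lo+L≤1+n = ≡.subst (_≤ suc n) (ℕP.+-suc lo L) lo+[1+L]≤1+n

    qPoch-≉0 : ∀ k → k ≤ n → qPoch q q k ≉ 0#
    qPoch-≉0 k k≤n = prodFrom-≉0 _ 0 k (λ j (_ , j<k) → 1-q^j≉0 (suc j) (s≤s z≤n) (ℕP.≤-trans j<k k≤n))

    prod-x-difference : ∀ i lo L → 1 ≤ i → i ≤ n → (∀ j → InRange lo L j → 1 ≤ j × j ≤ n) →
      prodFrom (λ j → x i - x j) lo L
        ≈ (κ * den i ⁻¹) ^ L * (prodFrom (λ j → q ^ i - q ^ j) lo L * prodFrom (λ j → den j ⁻¹) lo L)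
    prod-x-difference i lo L 1≤i i≤n index = begin
      prodFrom (λ j → x i - x j) lo L
        ≈⟨ prodFrom-cong lo L (λ j r → trans (difference j r)
             (solve 5 (λ k a b d e → k :* (a :- b) :* d :* e := (k :* d) :* ((a :- b) :* e)) refl κ (q ^ i) (q ^ j) (den i ⁻¹) (den j ⁻¹))) ⟩
      prodFrom (λ j → (κ * den i ⁻¹) * ((q ^ i - q ^ j) * den j ⁻¹)) lo L
        ≈⟨ prodFrom-distrib-* _ _ lo L ⟩
      prodFrom (λ _ → κ * den i ⁻¹) lo L * prodFrom (λ j → (q ^ i - q ^ j) * den j ⁻¹) lo L
        ≈⟨ *-cong (prodFrom-const _ lo L) (prodFrom-distrib-* _ _ lo L) ⟩
      (κ * den i ⁻¹) ^ L * (prodFrom (λ j → q ^ i - q ^ j) lo L * prodFrom (λ j → den j ⁻¹) lo L) ∎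
      where
      difference : ∀ j → InRange lo L j → x i - x j ≈ κ * (q ^ i - q ^ j) * den i ⁻¹ * den j ⁻¹
      difference j r = ratio-difference i j (den≉0 i 1≤i i≤n) (den≉0 j (proj₁ (index j r)) (proj₂ (index j r)))

    cqPoch : Carrier
    cqPoch = c ^ n * qPoch (z * q / c) q n

    c^L*qPoch≈prodFrom-den : ∀ k L → c ^ L * prodFrom (λ j → 1# - (z * q / c) * q ^ j) k L ≈ prodFrom den (suc k) L
    c^L*qPoch≈prodFrom-den k zero = *-identityˡ 1#
    c^L*qPoch≈prodFrom-den k (suc L) = begin
      (c * c ^ L) * ((1# - (z * q * c ⁻¹) * q ^ k) * rest)
        ≈⟨ solve 7 (λ c cL z q c⁻¹ qk r → (c :* cL) :* ((con (+ 1) :- (z :* q :* c⁻¹) :* qk) :* r)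
                     := (c :- (c :* c⁻¹) :* (z :* (q :* qk))) :* (cL :* r)) refl c (c ^ L) z q (c ⁻¹) (q ^ k) rest ⟩
      (c - (c * c ⁻¹) * (z * (q * q ^ k))) * (c ^ L * rest)
        ≈⟨ *-cong (+-congˡ (-‿cong (trans (*-congʳ (⁻¹-inverseʳ c≉0)) (*-identityˡ _)))) (c^L*qPoch≈prodFrom-den (suc k) L) ⟩
      den (suc k) * prodFrom den (suc (suc k)) L ∎
      where rest = prodFrom (λ j → 1# - (z * q / c) * q ^ j) (suc k) L

    κ-power-≉0 : κ ^ℤ (+ n ℤ.- + 1) ≉ 0#
    κ-power-≉0 = ≡.subst (λ e → κ ^ℤ e ≉ 0#) (≡.sym (ℤP.[+m]-[+n]≡m⊖n n 1)) (^ℤ-⊖-≉0 n 1 κ≉0)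

    κ-power⁻¹ : (κ ^ℤ (+ n ℤ.- + 1)) ⁻¹ ≈ (κ ⁻¹) ^ n * κ ^ 1
    κ-power⁻¹ = trans (reflexive (≡.cong (λ e → (κ ^ℤ e) ⁻¹) (ℤP.[+m]-[+n]≡m⊖n n 1))) (⁻¹-^ℤ-⊖ n 1 κ≉0)

    prefactor : Carrier
    prefactor = cqPoch / (qPoch q q n * (κ ^ℤ (+ n ℤ.- + 1)))

    prefactor≈ : prefactor ≈ cqPoch * (qPoch q q n ⁻¹ * ((κ ⁻¹) ^ n * κ ^ 1))
    prefactor≈ = *-congˡ (trans (⁻¹-distrib-* (qPoch-≉0 n ℕP.≤-refl) κ-power-≉0) (*-congˡ κ-power⁻¹))

    summand : ℕ → ℕ → Carrier
    summand m i = gauss q n i *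
        (((- 1#) ^ (i ∸ 1) * q ^ℤ (+ (suc i C 2) ℤ.- + (n ℕ.* i)) * (1# - q ^ i) * num i ^ m)
          / (den i ^ℤ (tau m n ℤ.+ + 1)))

    module LagrangeTerm (m i′ : ℕ) (i≤n : suc i′ ≤ n) where
      i r : ℕ
      i = suc i′
      r = n ∸ i

      1≤n : 1 ≤ n
      1≤n = ℕP.≤-trans (s≤s z≤n) i≤n

      i+r≡n : i ℕ.+ r ≡ n
      i+r≡n = ℕP.m+[n∸m]≡n i≤n

      below : ∀ j → InRange 1 i′ j → 1 ≤ j × j ≤ n
      below j (1≤j , j<i) = 1≤j , ℕP.≤-trans (ℕP.<⇒≤ j<i) i≤n

      above : ∀ j → InRange (suc i) r j → 1 ≤ j × j ≤ n
      above j (i<j , j<1+n) = ℕP.≤-trans (s≤s z≤n) (ℕP.<⇒≤ i<j) , ℕP.≤-pred (≡.subst (j <_) (≡.cong suc i+r≡n) j<1+n)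

      den-i≉0 : den i ≉ 0#
      den-i≉0 = den≉0 i (s≤s z≤n) i≤n

      den-≉0 : ∀ {lo L} → (∀ j → InRange lo L j → 1 ≤ j × j ≤ n) → ∀ j → InRange lo L j → den j ≉ 0#
      den-≉0 index j j∈ = den≉0 j (proj₁ (index j j∈)) (proj₂ (index j j∈))

      nodeProdˡ nodeProdʳ nodeProd : Carrier
      nodeProdˡ = prodFrom (λ j → x i - x j) 1 i′
      nodeProdʳ = prodFrom (λ j → x i - x j) (suc i) r
      nodeProd = nodeProdˡ * nodeProdʳ

      x-x≉0-below : ∀ j → InRange 1 i′ j → x i - x j ≉ 0#
      x-x≉0-below j (1≤j , j<i) = x-difference-≉0 1≤j j<i i≤n

      x-x≉0-above : ∀ j → InRange (suc i) r j → x i - x j ≉ 0#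
      x-x≉0-above j j∈ = x-y≉0⇒y-x≉0 (x-difference-≉0 (s≤s z≤n) (proj₁ j∈) (proj₂ (above j j∈)))

      nodeProd≉0 : nodeProd ≉ 0#
      nodeProd≉0 = *-≉0 (prodFrom-≉0 _ 1 i′ x-x≉0-below) (prodFrom-≉0 _ (suc i) r x-x≉0-above)

      lagrangeWeight≈nodeProd⁻¹ : lagrangeWeight n i ≈ nodeProd ⁻¹
      lagrangeWeight≈nodeProd⁻¹ = begin
        prodFrom (λ j → (x i - x j) ⁻¹) 1 i′ * prodFrom (λ j → (x i - x j) ⁻¹) (suc i) r
          ≈⟨ *-cong (prodFrom-⁻¹ _ 1 i′ x-x≉0-below) (prodFrom-⁻¹ _ (suc i) r x-x≉0-above) ⟩
        nodeProdˡ ⁻¹ * nodeProdʳ ⁻¹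
          ≈⟨ ⁻¹-distrib-* (prodFrom-≉0 _ 1 i′ x-x≉0-below) (prodFrom-≉0 _ (suc i) r x-x≉0-above) ⟨
        nodeProd ⁻¹ ∎

      P Ql Qh Dl Dh : Carrier
      P = κ * den i ⁻¹
      Ql = prodFrom (λ j → q ^ i - q ^ j) 1 i′
      Qh = prodFrom (λ j → q ^ i - q ^ j) (suc i) r
      Dl = prodFrom (λ j → den j ⁻¹) 1 i′
      Dh = prodFrom (λ j → den j ⁻¹) (suc i) r

      nodeProd-factorised : nodeProd ≈ P ^ (n ∸ 1) * ((Ql * Qh) * (Dl * Dh))
      nodeProd-factorised = begin
        nodeProdˡ * nodeProdʳ
          ≈⟨ *-cong (prod-x-difference i 1 i′ (s≤s z≤n) i≤n below) (prod-x-difference i (suc i) r (s≤s z≤n) i≤n above) ⟩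
        (P ^ i′ * (Ql * Dl)) * (P ^ r * (Qh * Dh))
          ≈⟨ trans (*-interchange _ _ _ _) (*-congˡ (*-interchange _ _ _ _)) ⟩
        (P ^ i′ * P ^ r) * ((Ql * Qh) * (Dl * Dh))
          ≈⟨ *-congʳ (^-homo-* P i′ r) ⟨
        P ^ (i′ ℕ.+ r) * ((Ql * Qh) * (Dl * Dh))
          ≡⟨ ≡.cong (λ e → P ^ e * ((Ql * Qh) * (Dl * Dh))) (≡.cong (_∸ 1) i+r≡n) ⟩
        P ^ (n ∸ 1) * ((Ql * Qh) * (Dl * Dh)) ∎

      cqPoch*D≈den-i : cqPoch * (Dl * Dh) ≈ den i
      cqPoch*D≈den-i = begin
        cqPoch * (Dl * Dh)
          ≈⟨ *-congʳ (c^L*qPoch≈prodFrom-den 0 n) ⟩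
        prodFrom den 1 n * (Dl * Dh)
          ≡⟨ ≡.cong (λ k → prodFrom den 1 k * (Dl * Dh)) (≡.trans (≡.sym i+r≡n) (≡.sym (ℕP.+-suc i′ r))) ⟩
        prodFrom den 1 (i′ ℕ.+ suc r) * (Dl * Dh)
          ≈⟨ *-congʳ (prodFrom-++ den 1 i′ (suc r)) ⟩
        (Cl * (den i * Ch)) * (Dl * Dh)
          ≈⟨ solve 5 (λ a d b e f → (a :* (d :* b)) :* (e :* f) := ((e :* a) :* (f :* b)) :* d) refl Cl (den i) Ch Dl Dh ⟩
        ((Dl * Cl) * (Dh * Ch)) * den i
          ≈⟨ *-congʳ (*-cong (prodFrom-⁻¹-inverseˡ den 1 i′ (den-≉0 below)) (prodFrom-⁻¹-inverseˡ den (suc i) r (den-≉0 above))) ⟩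
        (1# * 1#) * den i
          ≈⟨ trans (*-congʳ (*-identityˡ 1#)) (*-identityˡ _) ⟩
        den i ∎
        where
        Cl = prodFrom den 1 i′
        Ch = prodFrom den (suc i) r

      Z : Carrier
      Z = qPoch q q i * qPoch q q r

      q-powers-cancel : ((q ^ (suc i C 2) * q ^ (i C 2)) * (q ^ i) ^ r) * (q ⁻¹) ^ (n ℕ.* i) ≈ 1#
      q-powers-cancel = begin
        ((q ^ (suc i C 2) * q ^ (i C 2)) * (q ^ i) ^ r) * (q ⁻¹) ^ (n ℕ.* i)
          ≈⟨ *-congʳ (*-cong (^-homo-* q (suc i C 2) (i C 2)) (sym (^-assocʳ q i r))) ⟨
        (q ^ (suc i C 2 ℕ.+ i C 2) * q ^ (i ℕ.* r)) * (q ⁻¹) ^ (n ℕ.* i)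
          ≈⟨ *-congʳ (^-homo-* q (suc i C 2 ℕ.+ i C 2) (i ℕ.* r)) ⟨
        q ^ ((suc i C 2 ℕ.+ i C 2) ℕ.+ i ℕ.* r) * (q ⁻¹) ^ (n ℕ.* i)
          ≡⟨ ≡.cong (λ e → q ^ e * (q ⁻¹) ^ (n ℕ.* i)) (BinomialExponents.[1+i]C2+iC2+i*[n∸i]≡n*i i n i≤n) ⟩
        q ^ (n ℕ.* i) * (q ⁻¹) ^ (n ℕ.* i)
          ≈⟨ ^-⁻¹-inverseʳ (n ℕ.* i) q≉0 ⟩
        1# ∎

      -- 1 - qⁱ completes (q;q)_{i-1} to (q;q)ᵢ, and the powers of q cancel because
      -- C(i+1,2) + C(i,2) + i(n-i) = ni.
      q-factors≈Z : (((Ql * Qh) * (- 1#) ^ i′) * (q ^ (suc i C 2) * (q ⁻¹) ^ (n ℕ.* i))) * (1# - q ^ i) ≈ Z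
      q-factors≈Z = begin
        (((Ql * Qh) * s) * (qa * qb)) * o
          ≈⟨ *-congʳ (*-congʳ (xy*z≈xz*y Ql Qh s)) ⟩
        (((Ql * s) * Qh) * (qa * qb)) * o
          ≈⟨ *-congʳ (*-congʳ (*-cong (prod-below i′) (prod-above i r))) ⟩
        (((q ^ (i C 2) * qPoch q q i′) * ((q ^ i) ^ r * qPoch q q r)) * (qa * qb)) * o
          ≈⟨ solve 7 (λ c p ir pr a b o → ((c :* p) :* (ir :* pr)) :* (a :* b) :* o := (((a :* c) :* ir) :* b) :* ((p :* o) :* pr))
               refl (q ^ (i C 2)) (qPoch q q i′) ((q ^ i) ^ r) (qPoch q q r) qa qb o ⟩
        (((qa * q ^ (i C 2)) * (q ^ i) ^ r) * qb) * ((qPoch q q i′ * o) * qPoch q q r)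
          ≈⟨ *-cong q-powers-cancel (*-congʳ (sym (prodFrom-snoc (λ j → 1# - q * q ^ j) 0 i′))) ⟩
        1# * Z
          ≈⟨ *-identityˡ Z ⟩
        Z ∎
        where
        s = (- 1#) ^ i′
        qa = q ^ (suc i C 2)
        qb = (q ⁻¹) ^ (n ℕ.* i)
        o = 1# - q ^ i

      κ-factors : ((κ ⁻¹) ^ n * κ ^ 1) * P ^ (n ∸ 1) ≈ (den i ⁻¹) ^ (n ∸ 1)
      κ-factors = begin
        ((κ ⁻¹) ^ n * κ ^ 1) * P ^ (n ∸ 1)
          ≈⟨ *-cong (*-congʳ (x^n≈x*x^[n∸1] (κ ⁻¹) 1≤n)) (^-distrib-* κ (den i ⁻¹) (n ∸ 1)) ⟩
        ((κ ⁻¹ * (κ ⁻¹) ^ k) * (κ * 1#)) * (κ ^ k * d ^ k)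
          ≈⟨ solve 5 (λ κ⁻¹ κ⁻ᵏ κ κᵏ dᵏ → ((κ⁻¹ :* κ⁻ᵏ) :* (κ :* con (+ 1))) :* (κᵏ :* dᵏ) := (κ⁻¹ :* κ) :* ((κᵏ :* κ⁻ᵏ) :* dᵏ))
               refl (κ ⁻¹) ((κ ⁻¹) ^ k) κ (κ ^ k) (d ^ k) ⟩
        (κ ⁻¹ * κ) * ((κ ^ k * (κ ⁻¹) ^ k) * d ^ k)
          ≈⟨ *-cong (⁻¹-inverseˡ κ≉0) (*-congʳ (^-⁻¹-inverseʳ k κ≉0)) ⟩
        1# * (1# * d ^ k)
          ≈⟨ trans (*-identityˡ _) (*-identityˡ _) ⟩
        d ^ k ∎
        where
        k = n ∸ 1
        d = den i ⁻¹

      den-powers : den i * ((den i ⁻¹) ^ (n ∸ 1) * ((den i ⁻¹) ^ suc (suc m) * den i ^ n)) ≈ (den i ⁻¹) ^ m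
      den-powers = begin
        y * (d ^ k * ((d * (d * d ^ m)) * y ^ n))
          ≈⟨ *-congˡ (*-congˡ (*-congˡ (x^n≈x*x^[n∸1] y 1≤n))) ⟩
        y * (d ^ k * ((d * (d * d ^ m)) * (y * y ^ k)))
          ≈⟨ solve 5 (λ y d dᵏ dᵐ yᵏ → y :* (dᵏ :* ((d :* (d :* dᵐ)) :* (y :* yᵏ))) := (y :* d) :* ((y :* d) :* ((yᵏ :* dᵏ) :* dᵐ)))
               refl y d (d ^ k) (d ^ m) (y ^ k) ⟩
        (y * d) * ((y * d) * ((y ^ k * d ^ k) * d ^ m))
          ≈⟨ *-cong (⁻¹-inverseʳ den-i≉0) (*-cong (⁻¹-inverseʳ den-i≉0) (*-congʳ (^-⁻¹-inverseʳ k den-i≉0))) ⟩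
        1# * (1# * (1# * d ^ m))
          ≈⟨ trans (*-identityˡ _) (trans (*-identityˡ _) (*-identityˡ _)) ⟩
        d ^ m ∎
        where
        y = den i
        d = den i ⁻¹
        k = n ∸ 1

      q-power≈ : q ^ℤ (+ (suc i C 2) ℤ.- + (n ℕ.* i)) ≈ q ^ (suc i C 2) * (q ⁻¹) ^ (n ℕ.* i)
      q-power≈ = trans (reflexive (≡.cong (q ^ℤ_) (ℤP.[+m]-[+n]≡m⊖n (suc i C 2) (n ℕ.* i)))) (^ℤ-⊖ (suc i C 2) (n ℕ.* i) q≉0)

      den-power⁻¹ : (den i ^ℤ (tau m n ℤ.+ + 1)) ⁻¹ ≈ (den i ⁻¹) ^ suc (suc m) * den i ^ n
      den-power⁻¹ = trans (reflexive (≡.cong (λ e → (den i ^ℤ e) ⁻¹) (tau+1≡2+m⊖n m n))) (⁻¹-^ℤ-⊖ (suc (suc m)) n den-i≉0)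

      prefactor*summand*nodeProd≈x^m : (prefactor * summand m i) * nodeProd ≈ x i ^ m
      prefactor*summand*nodeProd≈x^m = begin
        (prefactor * summand m i) * nodeProd
          ≈⟨ *-cong (*-cong prefactor≈ (*-congˡ (*-cong (*-congʳ (*-congʳ (*-congˡ q-power≈))) den-power⁻¹))) nodeProd-factorised ⟩
        (cqPoch * (qn ⁻¹ * κs)) * ((qn * Z ⁻¹) * ((((s * qs) * o) * A) * Ds)) * (P ^ (n ∸ 1) * (Q * D))
          ≈⟨ solve 13 (λ Y qn⁻¹ κs qn Z⁻¹ s qs o A Ds Pᵏ Q D →
               (Y :* (qn⁻¹ :* κs)) :* ((qn :* Z⁻¹) :* ((((s :* qs) :* o) :* A) :* Ds)) :* (Pᵏ :* (Q :* D))
               := A :* ((Y :* D) :* ((qn⁻¹ :* qn) :* ((Z⁻¹ :* (((Q :* s) :* qs) :* o)) :* ((κs :* Pᵏ) :* Ds)))))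
               refl cqPoch (qn ⁻¹) κs qn (Z ⁻¹) s qs o A Ds (P ^ (n ∸ 1)) Q D ⟩
        A * ((cqPoch * D) * ((qn ⁻¹ * qn) * ((Z ⁻¹ * (((Q * s) * qs) * o)) * ((κs * P ^ (n ∸ 1)) * Ds))))
          ≈⟨ *-congˡ (*-cong cqPoch*D≈den-i (*-cong (⁻¹-inverseˡ (qPoch-≉0 n ℕP.≤-refl))
                       (*-cong (trans (*-congˡ q-factors≈Z) (⁻¹-inverseˡ Z≉0)) (*-congʳ κ-factors)))) ⟩
        A * (den i * (1# * (1# * ((den i ⁻¹) ^ (n ∸ 1) * Ds))))
          ≈⟨ *-congˡ (*-congˡ (trans (*-identityˡ _) (*-identityˡ _))) ⟩
        A * (den i * ((den i ⁻¹) ^ (n ∸ 1) * Ds))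
          ≈⟨ *-congˡ den-powers ⟩
        A * (den i ⁻¹) ^ m
          ≈⟨ ^-distrib-* (num i) (den i ⁻¹) m ⟨
        x i ^ m ∎
        where
        qn = qPoch q q n
        κs = (κ ⁻¹) ^ n * κ ^ 1
        s = (- 1#) ^ i′
        qs = q ^ (suc i C 2) * (q ⁻¹) ^ (n ℕ.* i)
        o = 1# - q ^ i
        A = num i ^ m
        Ds = (den i ⁻¹) ^ suc (suc m) * den i ^ n
        Q = Ql * Qh
        D = Dl * Dh
        Z≉0 : Z ≉ 0#
        Z≉0 = *-≉0 (qPoch-≉0 i i≤n) (qPoch-≉0 r (ℕP.m∸n≤m n i))

      x^m*lagrangeWeight : x i ^ m * lagrangeWeight n i ≈ prefactor * summand m i
      x^m*lagrangeWeight = begin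
        x i ^ m * lagrangeWeight n i                ≈⟨ *-congˡ lagrangeWeight≈nodeProd⁻¹ ⟩
        x i ^ m * nodeProd ⁻¹                       ≈⟨ *-congʳ prefactor*summand*nodeProd≈x^m ⟨
        ((prefactor * summand m i) * nodeProd) * nodeProd ⁻¹
                                                    ≈⟨ *-assoc _ _ _ ⟩
        (prefactor * summand m i) * (nodeProd * nodeProd ⁻¹)
                                                    ≈⟨ *-congˡ (⁻¹-inverseʳ nodeProd≉0) ⟩
        (prefactor * summand m i) * 1#              ≈⟨ *-identityʳ _ ⟩
        prefactor * summand m i                     ∎

    x^m*lagrangeWeight : ∀ m i → InRange 1 n i → x i ^ m * lagrangeWeight n i ≈ prefactor * summand m i
    x^m*lagrangeWeight m (suc i′) (_ , i<1+n) = LagrangeTerm.x^m*lagrangeWeight m i′ (ℕP.≤-pred i<1+n)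

    main-identity : ∀ m → lhs m n a b c z q ≈ rhs m n a b c z q
    main-identity m = begin
      hSum n x (tau m n)                                     ≡⟨ ≡.cong (hSum n x) (tau≡1+m⊖n m n) ⟩
      hSum n x (suc m ⊖ n)                                   ≈⟨ hSum≈hℤ n (suc m ⊖ n) ⟩
      hℤ (suc m ⊖ n) (nodes 1 n)                             ≡⟨ ≡.cong (λ L → hℤ (suc m ⊖ L) (nodes 1 n)) (length-nodes 1 n) ⟨
      hℤ (suc m ⊖ length (nodes 1 n)) (nodes 1 n)            ≈⟨ divDiff-^ m (nodes 1 n) (Distinct-nodes 1 n ℕP.≤-refl ℕP.≤-refl) ⟨
      divDiff (_^ m) (nodes 1 n)                             ≈⟨ divDiff-nodes n (_^ m) ⟩
      sumFrom (λ i → x i ^ m * lagrangeWeight n i) 1 n       ≈⟨ sumFrom-cong 1 n (x^m*lagrangeWeight m) ⟩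
      sumFrom (λ i → prefactor * summand m i) 1 n            ≈⟨ *-distribˡ-sumFrom prefactor (summand m) 1 n ⟨
      prefactor * sumFrom (summand m) 1 n                    ∎

    special-case : lhsSpecial n a b c z q ≈ rhsSpecial n a b c z q
    special-case = begin
      sumFrom x 1 n                              ≈⟨ sumFrom-cong 1 n (λ i _ → *-identityʳ (x i)) ⟨
      sumFrom (λ i → x i * 1#) 1 n               ≡⟨ ≡.cong (hSum n x) (tau-n-n≡1 n) ⟨
      lhs n n a b c z q                          ≈⟨ main-identity n ⟩
      rhs n n a b c z q                          ≡⟨ ≡.cong (λ e → prefactor * sumFrom (summand′ e) 1 n) (≡.cong (ℤ._+ + 1) (tau-n-n≡1 n)) ⟩
      rhsSpecial n a b c z q                     ∎
      where
      summand′ : ℤ → ℕ → Carrier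
      summand′ e i = gauss q n i *
        (((- 1#) ^ (i ∸ 1) * q ^ℤ (+ (suc i C 2) ℤ.- + (n ℕ.* i)) * (1# - q ^ i) * num i ^ n) / (den i ^ℤ e))

proposition1 : ∀ {ℓ₁ ℓ₂} (F : Field ℓ₁ ℓ₂) → let open Field F in let open FieldDefs F in
    (m n : ℕ) (a b c z q : Carrier) →
    ¬ (q ≈ 0#) → ¬ (c ≈ 0#) → ¬ ((a * z - b * c) ≈ 0#) →
    (∀ j → 1 ≤ j → j ≤ n → ¬ ((1# - q ^ j) ≈ 0#)) →
    (∀ j → 1 ≤ j → j ≤ n → ¬ ((c - z * q ^ j) ≈ 0#)) →
    (lhs m n a b c z q ≈ rhs m n a b c z q)
      × (lhsSpecial n a b c z q ≈ rhsSpecial n a b c z q)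
proposition1 F m n a b c z q q≉0 c≉0 κ≉0 1-q^j≉0 den≉0 = main-identity m , special-case
  where open Proposition1.Instance F a b c z q n q≉0 c≉0 κ≉0 1-q^j≉0 den≉0
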